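{- For every positive integer $n$, the poset $B_{3,n}$ is a distributive lattice.
   Context: For $n\ge 1$, $B_{3,n}$ is the poset on the $2n+6$ elements $\{a,b,c,d,e,f,1',1,2',2,\ldots,n',n\}$ whose order relation is the reflexive–transitive closure of the following cover relations (written $x\lessdot y$ meaning $y$ covers $x$): $(i+1)\lessdot i$ and $(i+1)'\lessdot i'$ for $1\le i\le n-1$; $i'\lessdot i$ for $1\le i\le n$; $1'\lessdot e$, $1'\lessdot f$; $1\lessdot b$, $1\lessdot c$; $e\lessdot b$, $e\lessdot d$; $f\lessdot c$, $f\lessdot d$; $b\lessdot a$, $c\lessdot a$, $d\lessdot a$. (So $\{1',1,e,f,b,c,d,a\}$ forms a copy of the Boolean algebra $B_3$ with bottom $1'$ and top $a$, and $B_{3,1}\cong B_3$.) -}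

module Defs where

open import Data.Nat using (ℕ; suc)
open import Data.Fin using (Fin; toℕ)
open import Relation.Binary.PropositionalEquality using (_≡_)
open import Relation.Binary.Construct.Closure.ReflexiveTransitive using (Star)

-- Elements of B_{3,n}.  For k : Fin n, `num k` is the element (toℕ k + 1)
-- and `prm k` is the element (toℕ k + 1)'.
data B3 (n : ℕ) : Set where
  a b c d e f : B3 n
  prm num : Fin n → B3 n

data _⋖_ {n : ℕ} : B3 n → B3 n → Set where
  num-step : ∀ {i j : Fin n} → toℕ j ≡ suc (toℕ i) → num j ⋖ num i
  prm-step : ∀ {i j : Fin n} → toℕ j ≡ suc (toℕ i) → prm j ⋖ prm i
  prm-num  : ∀ {i : Fin n} → prm i ⋖ num i
  1'⋖e : ∀ {i : Fin n} → toℕ i ≡ 0 → prm i ⋖ e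
  1'⋖f : ∀ {i : Fin n} → toℕ i ≡ 0 → prm i ⋖ f
  1⋖b  : ∀ {i : Fin n} → toℕ i ≡ 0 → num i ⋖ b
  1⋖c  : ∀ {i : Fin n} → toℕ i ≡ 0 → num i ⋖ c
  e⋖b : e ⋖ b
  e⋖d : e ⋖ d
  f⋖c : f ⋖ c
  f⋖d : f ⋖ d
  b⋖a : b ⋖ a
  c⋖a : c ⋖ a
  d⋖a : d ⋖ a

_≤B_ : ∀ {n} → B3 n → B3 n → Set
_≤B_ = Star _⋖_

-- Following Birkhoff, code an element of B_{3,n} by (t , s , u , v) : ℕ × Bool × Bool × Bool:
-- t is its position on the chains (i and i' have t = i - 1, the cube above 1' has t = 0),
-- s says whether it lies above n, and u, v whether it lies above e, resp. f.  Ordering t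
-- reversed and the bits as usual, this is an order embedding into a product of chains,
-- whose image {t < n, and t = 0 or u = v = false} is closed under componentwise joins and
-- meets.  A sublattice of a distributive lattice is distributive.
module Submission where

open import Defs
open import Data.Nat using (ℕ; _≤_)
open import Data.Product using (∃₂)
open import Relation.Binary.PropositionalEquality using (_≡_)
open import Relation.Binary.Lattice.Structures using (IsDistributiveLattice)

open import Algebra.Core using (Op₂)
open import Data.Bool using (Bool; true; false; _∨_; _∧_; b≤b; f≤t) renaming (_≤_ to _≤ᵇ_)
import Data.Bool.Properties as Bool
open import Data.Fin using (Fin; toℕ; fromℕ<; inject₁) renaming (zero to fzero; suc to fsuc)
open import Data.Fin.Properties using (toℕ-injective; toℕ-inject₁; toℕ-fromℕ<; toℕ≤pred[n])
open import Data.Nat using (zero; suc; _+_; _∸_; _⊓_; _⊔_; _≥_; z≤n; s≤s)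
open import Data.Nat.Properties
  using ( ≤-isPartialOrder; ≤-refl; ≤-trans; ≤-reflexive; n≤1+n; m∸n+n≡m; suc-injective
        ; m⊓n≤m; m⊓n≤n; m≤m⊔n; m≤n⊔m; ⊓-glb; ⊔-lub; ⊓-monoˡ-≤; ⊓-zeroʳ
        ; ⊔-distribˡ-⊓; m≤n⇒m⊓n≡m)
open import Data.Product using (_×_; _,_; zip′)
open import Data.Product.Relation.Binary.Pointwise.NonDependent using (Pointwise; ×-isPartialOrder)
open import Data.Sum using (_⊎_; inj₁; inj₂)
open import Function using (_on_)
open import Level using (Level)
open import Relation.Binary.Core using (Rel)
open import Relation.Binary.Construct.Closure.ReflexiveTransitive using (Star; ε; _◅_; _◅◅_; gmap; fold)
import Relation.Binary.Construct.Flip.EqAndOrd as Flip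
open import Relation.Binary.Lattice.Bundles using (DistributiveLattice)
open import Relation.Binary.Morphism.Structures using (IsOrderMonomorphism)
import Relation.Binary.Morphism.OrderMonomorphism as OrderMonomorphism
open import Relation.Binary.PropositionalEquality using (refl; sym; trans; cong; subst₂)
import Relation.Binary.Reasoning.Setoid as SetoidReasoning

private
  variable
    ℓ ℓ′ ℓ₁ ℓ₂ ℓ₃ ℓ₄ : Level
    A : Set ℓ
    B : Set ℓ′

module _ {_≈₁_ : Rel A ℓ₁} {_≤₁_ : Rel A ℓ₂} {_∨₁_ _∧₁_ : Op₂ A}
         {_≈₂_ : Rel B ℓ₃} {_≤₂_ : Rel B ℓ₄} {_∨₂_ _∧₂_ : Op₂ B} where

  ×-isDistributiveLattice : IsDistributiveLattice _≈₁_ _≤₁_ _∨₁_ _∧₁_ →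
                            IsDistributiveLattice _≈₂_ _≤₂_ _∨₂_ _∧₂_ →
                            IsDistributiveLattice (Pointwise _≈₁_ _≈₂_) (Pointwise _≤₁_ _≤₂_)
                                                  (zip′ _∨₁_ _∨₂_) (zip′ _∧₁_ _∧₂_)
  ×-isDistributiveLattice L M = record
    { isLattice = record
      { isPartialOrder = ×-isPartialOrder L.isPartialOrder M.isPartialOrder
      ; supremum       = λ { (x₁ , x₂) (y₁ , y₂) →
          (L.x≤x∨y x₁ y₁ , M.x≤x∨y x₂ y₂) , (L.y≤x∨y x₁ y₁ , M.y≤x∨y x₂ y₂) ,
          λ { _ (p₁ , p₂) (q₁ , q₂) → L.∨-least p₁ q₁ , M.∨-least p₂ q₂ } }
      ; infimum        = λ { (x₁ , x₂) (y₁ , y₂) →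
          (L.x∧y≤x x₁ y₁ , M.x∧y≤x x₂ y₂) , (L.x∧y≤y x₁ y₁ , M.x∧y≤y x₂ y₂) ,
          λ { _ (p₁ , p₂) (q₁ , q₂) → L.∧-greatest p₁ q₁ , M.∧-greatest p₂ q₂ } }
      }
    ; ∧-distribˡ-∨ = λ { (x₁ , x₂) (y₁ , y₂) (z₁ , z₂) →
        L.∧-distribˡ-∨ x₁ y₁ z₁ , M.∧-distribˡ-∨ x₂ y₂ z₂ }
    }
    where module L = IsDistributiveLattice L
          module M = IsDistributiveLattice M

  pullback-isDistributiveLattice :
    {⟦_⟧ : A → B} → IsOrderMonomorphism _≈₁_ _≈₂_ _≤₁_ _≤₂_ ⟦_⟧ →
    IsDistributiveLattice _≈₂_ _≤₂_ _∨₂_ _∧₂_ →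
    (∀ x y → ⟦ x ∨₁ y ⟧ ≈₂ (⟦ x ⟧ ∨₂ ⟦ y ⟧)) →
    (∀ x y → ⟦ x ∧₁ y ⟧ ≈₂ (⟦ x ⟧ ∧₂ ⟦ y ⟧)) →
    IsDistributiveLattice _≈₁_ _≤₁_ _∨₁_ _∧₁_
  pullback-isDistributiveLattice {⟦_⟧} emb L ⟦∨⟧ ⟦∧⟧ = record
    { isLattice = record
      { isPartialOrder = OrderMonomorphism.isPartialOrder emb L.isPartialOrder
      ; supremum       = λ x y →
          cancel (≤-respʳ-≈ (Eq.sym (⟦∨⟧ x y)) (L.x≤x∨y _ _)) ,
          cancel (≤-respʳ-≈ (Eq.sym (⟦∨⟧ x y)) (L.y≤x∨y _ _)) ,
          λ _ p q → cancel (≤-respˡ-≈ (Eq.sym (⟦∨⟧ x y)) (L.∨-least (mono p) (mono q)))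
      ; infimum        = λ x y →
          cancel (≤-respˡ-≈ (Eq.sym (⟦∧⟧ x y)) (L.x∧y≤x _ _)) ,
          cancel (≤-respˡ-≈ (Eq.sym (⟦∧⟧ x y)) (L.x∧y≤y _ _)) ,
          λ _ p q → cancel (≤-respʳ-≈ (Eq.sym (⟦∧⟧ x y)) (L.∧-greatest (mono p) (mono q)))
      }
    ; ∧-distribˡ-∨ = λ x y z → injective (begin
        ⟦ x ∧₁ (y ∨₁ z) ⟧                 ≈⟨ ⟦∧⟧ x (y ∨₁ z) ⟩
        ⟦ x ⟧ ∧₂ ⟦ y ∨₁ z ⟧               ≈⟨ ∧-cong Eq.refl (⟦∨⟧ y z) ⟩
        ⟦ x ⟧ ∧₂ (⟦ y ⟧ ∨₂ ⟦ z ⟧)         ≈⟨ L.∧-distribˡ-∨ _ _ _ ⟩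
        (⟦ x ⟧ ∧₂ ⟦ y ⟧) ∨₂ (⟦ x ⟧ ∧₂ ⟦ z ⟧) ≈⟨ ∨-cong (⟦∧⟧ x y) (⟦∧⟧ x z) ⟨
        ⟦ x ∧₁ y ⟧ ∨₂ ⟦ x ∧₁ z ⟧           ≈⟨ ⟦∨⟧ (x ∧₁ y) (x ∧₁ z) ⟨
        ⟦ (x ∧₁ y) ∨₁ (x ∧₁ z) ⟧          ∎)
    }
    where
    module L = IsDistributiveLattice L
    open L using (module Eq; ≤-respˡ-≈; ≤-respʳ-≈)
    open IsOrderMonomorphism emb using (mono; cancel; injective)
    bundle : DistributiveLattice _ _ _
    bundle = record { isDistributiveLattice = L }
    open DistributiveLattice bundle using (joinSemilattice; meetSemilattice; setoid)
    open import Relation.Binary.Lattice.Properties.JoinSemilattice joinSemilattice using (∨-cong)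
    open import Relation.Binary.Lattice.Properties.MeetSemilattice meetSemilattice using (∧-cong)
    open SetoidReasoning setoid

≥-⊓-⊔-isDistributiveLattice : IsDistributiveLattice _≡_ _≥_ _⊓_ _⊔_
≥-⊓-⊔-isDistributiveLattice = record
  { isLattice = record
    { isPartialOrder = Flip.isPartialOrder ≤-isPartialOrder
    ; supremum       = λ x y → m⊓n≤m x y , m⊓n≤n x y , λ _ → ⊓-glb
    ; infimum        = λ x y → m≤m⊔n x y , m≤n⊔m x y , λ _ → ⊔-lub
    }
  ; ∧-distribˡ-∨ = ⊔-distribˡ-⊓
  }

≤-∨-∧-isDistributiveLattice : IsDistributiveLattice _≡_ _≤ᵇ_ _∨_ _∧_
≤-∨-∧-isDistributiveLattice = record
  { isLattice = record
    { isPartialOrder = Bool.≤-isPartialOrder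
    ; supremum       = λ x y → x≤x∨y x y , y≤x∨y x y , λ _ → ∨-least
    ; infimum        = λ x y → x∧y≤x x y , x∧y≤y x y , λ _ → ∧-greatest
    }
  ; ∧-distribˡ-∨ = Bool.∧-distribˡ-∨
  }
  where
  x≤x∨y : ∀ x y → x ≤ᵇ x ∨ y
  x≤x∨y false y = Bool.≤-minimum y
  x≤x∨y true  y = b≤b
  y≤x∨y : ∀ x y → y ≤ᵇ x ∨ y
  y≤x∨y false y = Bool.≤-refl
  y≤x∨y true  y = Bool.≤-maximum y
  ∨-least : ∀ {x y z} → x ≤ᵇ z → y ≤ᵇ z → x ∨ y ≤ᵇ z
  ∨-least {false} _ y≤z = y≤z
  ∨-least {true}  x≤z _ = x≤z
  x∧y≤x : ∀ x y → x ∧ y ≤ᵇ x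
  x∧y≤x false y = b≤b
  x∧y≤x true  y = Bool.≤-maximum y
  x∧y≤y : ∀ x y → x ∧ y ≤ᵇ y
  x∧y≤y false y = Bool.≤-minimum y
  x∧y≤y true  y = Bool.≤-refl
  ∧-greatest : ∀ {x y z} → z ≤ᵇ x → z ≤ᵇ y → z ≤ᵇ x ∧ y
  ∧-greatest {false} z≤x _ = z≤x
  ∧-greatest {true}  _ z≤y = z≤y

_IsSucOf_ : ∀ {n} → Rel (Fin n) _
j IsSucOf i = toℕ j ≡ suc (toℕ i)

descend : ∀ {n} {i j : Fin n} → toℕ j ≤ toℕ i → Star _IsSucOf_ i j
descend {i = i} {j} j≤i = go (toℕ i ∸ toℕ j) (sym (m∸n+n≡m j≤i))
  where
  go : ∀ k {i} → toℕ i ≡ k + toℕ j → Star _IsSucOf_ i j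
  go zero    eq with toℕ-injective eq
  ... | refl = ε
  go (suc k) {fzero}  ()
  go (suc k) {fsuc i} eq =
    cong suc (sym (toℕ-inject₁ i)) ◅ go k (trans (toℕ-inject₁ i) (suc-injective eq))

prm-chain : ∀ {n} {i j : Fin n} → toℕ j ≤ toℕ i → prm i ≤B prm j
prm-chain j≤i = gmap prm prm-step (descend j≤i)

num-chain : ∀ {n} {i j : Fin n} → toℕ j ≤ toℕ i → num i ≤B num j
num-chain j≤i = gmap num num-step (descend j≤i)

level : ∀ {n} → Bool → Fin n → B3 n
level false = prm
level true  = num

level-mono : ∀ {n s s′} {i j : Fin n} → s ≤ᵇ s′ → toℕ j ≤ toℕ i → level s i ≤B level s′ j
level-mono {s = false} b≤b j≤i = prm-chain j≤i
level-mono {s = true}  b≤b j≤i = num-chain j≤i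
level-mono             f≤t j≤i = prm-chain j≤i ◅◅ prm-num ◅ ε

Code : Set
Code = ℕ × Bool × Bool × Bool

_≈ᶜ_ _≤ᶜ_ : Rel Code _
_≈ᶜ_ = Pointwise _≡_ (Pointwise _≡_ (Pointwise _≡_ _≡_))
_≤ᶜ_ = Pointwise _≥_ (Pointwise _≤ᵇ_ (Pointwise _≤ᵇ_ _≤ᵇ_))

_∨ᶜ_ _∧ᶜ_ : Op₂ Code
_∨ᶜ_ = zip′ _⊓_ (zip′ _∨_ (zip′ _∨_ _∨_))
_∧ᶜ_ = zip′ _⊔_ (zip′ _∧_ (zip′ _∧_ _∧_))

Code-isDistributiveLattice : IsDistributiveLattice _≈ᶜ_ _≤ᶜ_ _∨ᶜ_ _∧ᶜ_
Code-isDistributiveLattice =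
  ×-isDistributiveLattice ≥-⊓-⊔-isDistributiveLattice
    (×-isDistributiveLattice ≤-∨-∧-isDistributiveLattice
      (×-isDistributiveLattice ≤-∨-∧-isDistributiveLattice ≤-∨-∧-isDistributiveLattice))

module CodeLattice = IsDistributiveLattice Code-isDistributiveLattice

≈ᶜ⇒≡ : ∀ {X Y} → X ≈ᶜ Y → X ≡ Y
≈ᶜ⇒≡ {_ , _ , _ , _} {_ , _ , _ , _} (refl , refl , refl , refl) = refl

encode : ∀ {n} → B3 n → Code
encode a       = 0 , true  , true  , true
encode b       = 0 , true  , true  , false
encode c       = 0 , true  , false , true
encode d       = 0 , false , true  , true
encode e       = 0 , false , true  , false
encode f       = 0 , false , false , true
encode (prm i) = toℕ i , false , false , false
encode (num i) = toℕ i , true  , false , false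

encode-cover : ∀ {n} {x y : B3 n} → x ⋖ y → encode x ≤ᶜ encode y
encode-cover (num-step eq) = ≤-trans (n≤1+n _) (≤-reflexive (sym eq)) , b≤b , b≤b , b≤b
encode-cover (prm-step eq) = ≤-trans (n≤1+n _) (≤-reflexive (sym eq)) , b≤b , b≤b , b≤b
encode-cover prm-num       = ≤-refl , f≤t , b≤b , b≤b
encode-cover (1'⋖e _)      = z≤n , b≤b , f≤t , b≤b
encode-cover (1'⋖f _)      = z≤n , b≤b , b≤b , f≤t
encode-cover (1⋖b _)       = z≤n , b≤b , f≤t , b≤b
encode-cover (1⋖c _)       = z≤n , b≤b , b≤b , f≤t
encode-cover e⋖b           = z≤n , f≤t , b≤b , b≤b
encode-cover e⋖d           = z≤n , b≤b , b≤b , f≤t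
encode-cover f⋖c           = z≤n , f≤t , b≤b , b≤b
encode-cover f⋖d           = z≤n , b≤b , f≤t , b≤b
encode-cover b⋖a           = z≤n , b≤b , b≤b , f≤t
encode-cover c⋖a           = z≤n , b≤b , f≤t , b≤b
encode-cover d⋖a           = z≤n , f≤t , b≤b , b≤b

encode-mono : ∀ {n} {x y : B3 n} → x ≤B y → encode x ≤ᶜ encode y
encode-mono = fold (_≤ᶜ_ on encode) (λ x⋖y → CodeLattice.trans (encode-cover x⋖y)) CodeLattice.refl

module _ {m : ℕ} where

  cube : Bool → Bool → Bool → B3 (suc m)
  cube s     false false = level s fzero
  cube false true  false = e
  cube false false true  = f
  cube false true  true  = d
  cube true  true  false = b
  cube true  false true  = c
  cube true  true  true  = a

  encode-cube : ∀ s u v → encode (cube s u v) ≡ (0 , s , u , v)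
  encode-cube false false false = refl
  encode-cube true  false false = refl
  encode-cube false true  false = refl
  encode-cube false false true  = refl
  encode-cube false true  true  = refl
  encode-cube true  true  false = refl
  encode-cube true  false true  = refl
  encode-cube true  true  true  = refl

  cube-monoˢ : ∀ {s s′ u v} → s ≤ᵇ s′ → cube s u v ≤B cube s′ u v
  cube-monoˢ                       b≤b = ε
  cube-monoˢ {u = false} {v = false} f≤t = prm-num ◅ ε
  cube-monoˢ {u = true}  {v = false} f≤t = e⋖b ◅ ε
  cube-monoˢ {u = false} {v = true}  f≤t = f⋖c ◅ ε
  cube-monoˢ {u = true}  {v = true}  f≤t = d⋖a ◅ ε

  cube-monoᵘ : ∀ {s u u′ v} → u ≤ᵇ u′ → cube s u v ≤B cube s u′ v
  cube-monoᵘ                       b≤b = ε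
  cube-monoᵘ {s = false} {v = false} f≤t = 1'⋖e refl ◅ ε
  cube-monoᵘ {s = true}  {v = false} f≤t = 1⋖b refl ◅ ε
  cube-monoᵘ {s = false} {v = true}  f≤t = f⋖d ◅ ε
  cube-monoᵘ {s = true}  {v = true}  f≤t = c⋖a ◅ ε

  cube-monoᵛ : ∀ {s u v v′} → v ≤ᵇ v′ → cube s u v ≤B cube s u v′
  cube-monoᵛ                       b≤b = ε
  cube-monoᵛ {s = false} {u = false} f≤t = 1'⋖f refl ◅ ε
  cube-monoᵛ {s = true}  {u = false} f≤t = 1⋖c refl ◅ ε
  cube-monoᵛ {s = false} {u = true}  f≤t = e⋖d ◅ ε
  cube-monoᵛ {s = true}  {u = true}  f≤t = b⋖a ◅ ε

  cube-mono : ∀ {s s′ u u′ v v′} → s ≤ᵇ s′ → u ≤ᵇ u′ → v ≤ᵇ v′ → cube s u v ≤B cube s′ u′ v′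
  cube-mono {s′ = s′} {u = u} {u′} {v} s≤s′ u≤u′ v≤v′ =
    cube-monoˢ {u = u} s≤s′ ◅◅ cube-monoᵘ {v = v} u≤u′ ◅◅ cube-monoᵛ {s′} {u′} v≤v′

  -- Truncates t to m; only the values t ≤ m are used.
  clamp : ℕ → Fin (suc m)
  clamp t = fromℕ< (s≤s (m⊓n≤n t m))

  toℕ-clamp : ∀ {t} → t ≤ m → toℕ (clamp t) ≡ t
  toℕ-clamp t≤m = trans (toℕ-fromℕ< _) (m≤n⇒m⊓n≡m t≤m)

  clamp-toℕ : ∀ i → clamp (toℕ i) ≡ i
  clamp-toℕ i = toℕ-injective (toℕ-clamp (toℕ≤pred[n] i))

  clamp-mono : ∀ {t t′} → t′ ≤ t → toℕ (clamp t′) ≤ toℕ (clamp t)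
  clamp-mono t′≤t =
    subst₂ _≤_ (sym (toℕ-fromℕ< _)) (sym (toℕ-fromℕ< _)) (⊓-monoˡ-≤ m t′≤t)

  decode : Code → B3 (suc m)
  decode (t , s , false , false) = level s (clamp t)
  decode (_ , s , u     , v)     = cube s u v

  decode-encode : ∀ x → decode (encode x) ≡ x
  decode-encode a       = refl
  decode-encode b       = refl
  decode-encode c       = refl
  decode-encode d       = refl
  decode-encode e       = refl
  decode-encode f       = refl
  decode-encode (prm i) = cong prm (clamp-toℕ i)
  decode-encode (num i) = cong num (clamp-toℕ i)

  decode≤cube : ∀ t s u v → decode (t , s , u , v) ≤B cube s u v
  decode≤cube t s false false = level-mono Bool.≤-refl z≤n
  decode≤cube t s false true  = ε
  decode≤cube t s true  v     = ε

  decode-mono : ∀ {X Y} → X ≤ᶜ Y → decode X ≤B decode Y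
  decode-mono {_ , s , u , v} {_ , _ , false , false} (t′≤t , s≤s′ , b≤b , b≤b) =
    level-mono s≤s′ (clamp-mono t′≤t)
  decode-mono {t , s , u , v} {_ , _ , false , true} (_ , s≤s′ , u≤u′ , v≤v′) =
    decode≤cube t s u v ◅◅ cube-mono s≤s′ u≤u′ v≤v′
  decode-mono {t , s , u , v} {_ , _ , true , _} (_ , s≤s′ , u≤u′ , v≤v′) =
    decode≤cube t s u v ◅◅ cube-mono s≤s′ u≤u′ v≤v′

  Image : Code → Set
  Image (t , _ , u , v) = t ≤ m × (t ≡ 0 ⊎ (u ≡ false × v ≡ false))

  encode-image : (x : B3 (suc m)) → Image (encode x)
  encode-image a       = z≤n , inj₁ refl
  encode-image b       = z≤n , inj₁ refl
  encode-image c       = z≤n , inj₁ refl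
  encode-image d       = z≤n , inj₁ refl
  encode-image e       = z≤n , inj₁ refl
  encode-image f       = z≤n , inj₁ refl
  encode-image (prm i) = toℕ≤pred[n] i , inj₂ (refl , refl)
  encode-image (num i) = toℕ≤pred[n] i , inj₂ (refl , refl)

  encode-decode : ∀ {X} → Image X → encode (decode X) ≡ X
  encode-decode {t , false , false , false} (t≤m , _) = cong (_, false , false , false) (toℕ-clamp t≤m)
  encode-decode {t , true  , false , false} (t≤m , _) = cong (_, true , false , false) (toℕ-clamp t≤m)
  encode-decode {_ , s , false , true} (_ , inj₁ refl) = encode-cube s false true
  encode-decode {_ , s , true  , v}    (_ , inj₁ refl) = encode-cube s true v
  encode-decode {_ , _ , false , true} (_ , inj₂ (_ , ()))
  encode-decode {_ , _ , true  , _}    (_ , inj₂ (() , _))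

  ∨ᶜ-image : ∀ {X Y} → Image X → Image Y → Image (X ∨ᶜ Y)
  ∨ᶜ-image {t , _} {t′ , _} (t≤m , p) (_ , q) = ≤-trans (m⊓n≤m t t′) t≤m , coherent p q
    where
    coherent : ∀ {u v u′ v′} → t ≡ 0 ⊎ (u ≡ false × v ≡ false) → t′ ≡ 0 ⊎ (u′ ≡ false × v′ ≡ false) →
               t ⊓ t′ ≡ 0 ⊎ (u ∨ u′ ≡ false × v ∨ v′ ≡ false)
    coherent (inj₁ refl)          _                    = inj₁ refl
    coherent _                    (inj₁ refl)          = inj₁ (⊓-zeroʳ t)
    coherent (inj₂ (refl , refl)) (inj₂ (refl , refl)) = inj₂ (refl , refl)

  ∧ᶜ-image : ∀ {X Y} → Image X → Image Y → Image (X ∧ᶜ Y)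
  ∧ᶜ-image {t , _} {t′ , _} (t≤m , p) (t′≤m , q) = ⊔-lub t≤m t′≤m , coherent p q
    where
    coherent : ∀ {u v u′ v′} → t ≡ 0 ⊎ (u ≡ false × v ≡ false) → t′ ≡ 0 ⊎ (u′ ≡ false × v′ ≡ false) →
               t ⊔ t′ ≡ 0 ⊎ (u ∧ u′ ≡ false × v ∧ v′ ≡ false)
    coherent (inj₂ (refl , refl)) _                    = inj₂ (refl , refl)
    coherent {u} {v} _            (inj₂ (refl , refl)) = inj₂ (Bool.∧-zeroʳ u , Bool.∧-zeroʳ v)
    coherent (inj₁ refl)          (inj₁ refl)          = inj₁ refl

  _∨ᴮ_ _∧ᴮ_ : Op₂ (B3 (suc m))
  x ∨ᴮ y = decode (encode x ∨ᶜ encode y)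
  x ∧ᴮ y = decode (encode x ∧ᶜ encode y)

  encode-∨ : ∀ x y → encode (x ∨ᴮ y) ≈ᶜ (encode x ∨ᶜ encode y)
  encode-∨ x y = CodeLattice.Eq.reflexive
    (encode-decode (∨ᶜ-image {encode x} {encode y} (encode-image x) (encode-image y)))

  encode-∧ : ∀ x y → encode (x ∧ᴮ y) ≈ᶜ (encode x ∧ᶜ encode y)
  encode-∧ x y = CodeLattice.Eq.reflexive
    (encode-decode (∧ᶜ-image {encode x} {encode y} (encode-image x) (encode-image y)))

  encode-isOrderMonomorphism : IsOrderMonomorphism _≡_ _≈ᶜ_ _≤B_ _≤ᶜ_ (encode {suc m})
  encode-isOrderMonomorphism = record
    { isOrderHomomorphism = record { cong = λ { refl → CodeLattice.Eq.refl } ; mono = encode-mono }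
    ; injective           = λ {x} {y} eq →
        subst₂ _≡_ (decode-encode x) (decode-encode y) (cong decode (≈ᶜ⇒≡ eq))
    ; cancel              = λ {x} {y} le →
        subst₂ _≤B_ (decode-encode x) (decode-encode y) (decode-mono le)
    }

lemma3p1 : (n : ℕ) → 1 ≤ n →
    ∃₂ λ (_∨_ _∧_ : B3 n → B3 n → B3 n) →
      IsDistributiveLattice {A = B3 n} _≡_ _≤B_ _∨_ _∧_
lemma3p1 zero    ()
lemma3p1 (suc m) _ =
  _∨ᴮ_ , _∧ᴮ_ ,
  pullback-isDistributiveLattice encode-isOrderMonomorphism Code-isDistributiveLattice encode-∨ encode-∧
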